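{- Let $k\ge 2$ and let $Y_k$ be the graph obtained from the complete graph $K_{k+3}$ on vertices $v_1,\dots,v_k,u,v,w$ by adding two new non-adjacent vertices $x$ and $y$, each adjacent exactly to $v_1,\dots,v_k$. Then $\mathrm{gp}_{\rm d}(Y_k)=5$ and $\mathrm{gp}_{\rm d}(Y_k-x)=k+3$.
   Context: All graphs are finite and simple. For a graph $G$ and $Z\subseteq V(G)$, two vertices $p,q\in V(G)$ are $Z$-positionable if no shortest $p,q$-path in $G$ has an internal vertex in $Z$. $Z$ is a dual general position set if every two vertices of $Z$ are $Z$-positionable and every two vertices of $V(G)\setminus Z$ are $Z$-positionable. $\mathrm{gp}_{\rm d}(G)$ is the maximum cardinality of a dual general position set of $G$. $G-x$ is the graph obtained by deleting $x$ and its incident edges. -}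

module Defs where

open import Data.Nat using (ℕ; zero; suc; _+_; _≤_; _<_)
open import Data.Fin using (Fin; toℕ; fromℕ<; punchIn)
open import Data.Fin.Subset using (Subset; _∈_; _∉_; ∣_∣)
open import Data.List using (List; []; _∷_; length)
import Data.List.Membership.Propositional as LM
open import Data.List.Relation.Unary.Unique.Propositional using (Unique)
open import Data.Product using (_×_; _,_; Σ; ∃)
open import Data.Sum using (_⊎_; inj₁; inj₂)
open import Relation.Binary.PropositionalEquality using (_≡_; _≢_; refl; sym; cong)
open import Relation.Nullary using (¬_)
open import Data.Fin.Properties using (punchIn-injective)
open import Data.Nat.Properties using (+-suc)

record Graph (n : ℕ) : Set₁ where
  field
    Adj    : Fin n → Fin n → Set
    symAdj : ∀ {i j} → Adj i j → Adj j i
    irrAdj : ∀ {i} → ¬ Adj i i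
open Graph public

module _ {n : ℕ} (G : Graph n) where

  data Walk : Fin n → Fin n → List (Fin n) → Set where
    single : ∀ {p} → Walk p p (p ∷ [])
    step   : ∀ {p r q vs} → Adj G p r → Walk r q vs → Walk p q (p ∷ vs)

  IsPath : Fin n → Fin n → List (Fin n) → Set
  IsPath p q P = Walk p q P × Unique P

  IsShortestPath : Fin n → Fin n → List (Fin n) → Set
  IsShortestPath p q P =
    IsPath p q P × (∀ Q → IsPath p q Q → length P ≤ length Q)

  Positionable : Subset n → Fin n → Fin n → Set
  Positionable Z p q =
    ∀ P → IsShortestPath p q P →
      ∀ z → z LM.∈ P → z ≢ p → z ≢ q → z ∉ Z

  IsDualGP : Subset n → Set
  IsDualGP Z =
    (∀ p q → p ∈ Z → q ∈ Z → Positionable Z p q) ×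
    (∀ p q → p ∉ Z → q ∉ Z → Positionable Z p q)

  GpdIs : ℕ → Set
  GpdIs m = (Σ (Subset n) λ Z → IsDualGP Z × ∣ Z ∣ ≡ m) ×
            (∀ Z → IsDualGP Z → ∣ Z ∣ ≤ m)

_-ᵥ_ : ∀ {n} → Graph (suc n) → Fin (suc n) → Graph n
G -ᵥ x = record
  { Adj    = λ i j → Adj G (punchIn x i) (punchIn x j)
  ; symAdj = symAdj G
  ; irrAdj = irrAdj G
  }

-- The graph Y_k on vertex set Fin (5 + k):
--   index i < k        : v_{i+1}
--   index k, k+1, k+2  : u, v, w
--   index k+3          : x
--   index k+4          : y
-- Vertices with index < k+3 form a clique K_{k+3}; x and y are each adjacent
-- exactly to v_1..v_k, and x,y are non-adjacent.
YRel : ℕ → ℕ → ℕ → Set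
YRel k a b = (a < k + 3 × b < k + 3)
           ⊎ (a < k × k + 3 ≤ b)
           ⊎ (k + 3 ≤ a × b < k)

YRel-sym : ∀ k a b → YRel k a b → YRel k b a
YRel-sym k a b (inj₁ (p , q)) = inj₁ (q , p)
YRel-sym k a b (inj₂ (inj₁ (p , q))) = inj₂ (inj₂ (q , p))
YRel-sym k a b (inj₂ (inj₂ (p , q))) = inj₂ (inj₁ (q , p))

Y : (k : ℕ) → Graph (5 + k)
Y k = record
  { Adj    = λ i j → i ≢ j × YRel k (toℕ i) (toℕ j)
  ; symAdj = λ { (ne , r) → (λ e → ne (sym e)) , YRel-sym k _ _ r }
  ; irrAdj = λ { (ne , _) → ne refl }
  }

xY : (k : ℕ) → Fin (5 + k)
xY k = fromℕ< {k + 3} lemma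
  where
  open import Data.Nat using (s≤s)
  open import Data.Nat.Properties using (+-comm; ≤-refl; m≤n⇒m≤1+n; n<1+n)
  open import Relation.Binary.PropositionalEquality using (subst)
  lemma : k + 3 < 5 + k
  lemma = subst (λ t → t < 5 + k) (+-comm 3 k)
            (m≤n⇒m≤1+n (n<1+n (3 + k)))

{-# OPTIONS --safe #-}
module Submission where

-- Every hub v_i of Y_k is adjacent to all other vertices, so the internal vertex of a shortest
-- p,q-path is a common neighbour of the distinct, non-adjacent p and q. A hub in a dual general
-- position set Z would be the centre of the claw on the pairwise non-adjacent x, y, u, two of
-- which lie on the same side of Z; so Z ⊆ {u, v, w, x, y}, and that set is in dual general
-- position because two of its vertices with a common neighbour inside it lie in the clique.
-- In Y_k − x both V ∖ {y} and {y} are cliques, while Z = V is excluded by the induced path y v₁ u.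

open import Defs
open import Data.Nat using (ℕ; _≤_; _+_; zero; suc; pred; _<_; _<?_; _∸_; z≤n; s≤s; z<s)
open import Data.Product using (_×_; _,_; proj₁; proj₂; Σ)
open import Data.Nat.Properties
  using (≤-trans; ≤-reflexive; <-≤-trans; ≤-<-trans; <-trans; <-irrefl; <⇒≱; ≮⇒≥; ≰⇒>; ≤∧≢⇒<; m≤m+n; m<m+n; m<n+m; m≤n⇒m≤1+n; m<1+n⇒m≤n; +-comm)
open import Data.Fin as Fin using (Fin; toℕ; fromℕ; fromℕ<; punchIn; punchOut; _≟_)
open import Data.Fin.Properties
  using (toℕ-fromℕ; toℕ-fromℕ<; toℕ-injective; ≤fromℕ; <⇒≢; punchIn-injective; punchIn-punchOut; punchInᵢ≢i)
  renaming (≤∧≢⇒< to ≤∧≢⇒<ᶠ)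
open import Data.Fin.Subset using (Subset; outside; ⊤; ⁅_⁆; ∁; _∈_; _∉_; _⊆_; ∣_∣)
open import Data.Fin.Subset.Properties
  using (_∈?_; ∈⊤; ⊆⊤; ∣⊤∣≡n; p⊆q⇒∣p∣≤∣q∣; p⊂q⇒∣p∣<∣q∣; ∣∁p∣≡n∸∣p∣; ∣⁅x⁆∣≡1; x∈∁p⇒x∉p; x∉∁p⇒x∈p; x∈⁅y⁆⇒x≡y; x∉⁅y⁆⇒x≢y)
open import Data.Vec using (_∷_; there)
open import Data.List using (List; []; _∷_; length)
open import Data.List.Membership.Propositional using () renaming (_∈_ to _∈ₗ_)
import Data.List.Relation.Unary.Any as Any
open import Data.List.Relation.Unary.AllPairs using ([]; _∷_)
open import Data.List.Relation.Unary.All using ([]; _∷_)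
open import Data.Sum using (_⊎_; inj₁; inj₂; [_,_])
open import Data.Empty using (⊥-elim)
open import Function using (_∘_)
open import Relation.Nullary using (¬_; yes; no)
open import Relation.Binary.PropositionalEquality
  using (_≡_; _≢_; refl; sym; trans; cong; subst; subst₂; ≢-sym; module ≡-Reasoning)

x∉p⇒∣p∣<n : ∀ {n} {p : Subset n} {x} → x ∉ p → ∣ p ∣ < n
x∉p⇒∣p∣<n {n} {p} {x} x∉p = subst (∣ p ∣ <_) (∣⊤∣≡n n) (p⊂q⇒∣p∣<∣q∣ (⊆⊤ , x , ∈⊤ , x∉p))

module _ {n : ℕ} (G : Graph n) where

  private variable
    p q c h z a b : Fin n
    P : List (Fin n)
    Z : Subset n

  Dist≤1 : Fin n → Fin n → Set
  Dist≤1 p q = p ≡ q ⊎ Adj G p q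

  InducedP₃ : Fin n → Fin n → Fin n → Set
  InducedP₃ p c q = Adj G p c × Adj G c q × ¬ Dist≤1 p q

  adj⇒≢ : Adj G p q → p ≢ q
  adj⇒≢ a refl = irrAdj G a

  walk-length≤2⇒endpoint : Walk G p q P → length P ≤ 2 → z ∈ₗ P → z ≡ p ⊎ z ≡ q
  walk-length≤2⇒endpoint single                    _ (Any.here z≡p)             = inj₁ z≡p
  walk-length≤2⇒endpoint (step _ single)           _ (Any.here z≡p)             = inj₁ z≡p
  walk-length≤2⇒endpoint (step _ single)           _ (Any.there (Any.here z≡q)) = inj₂ z≡q
  walk-length≤2⇒endpoint (step _ (step _ single))   (s≤s (s≤s ())) _
  walk-length≤2⇒endpoint (step _ (step _ (step _ _))) (s≤s (s≤s ())) _

  walk-length≤3⇒middle : Walk G p q P → length P ≤ 3 → z ∈ₗ P → z ≢ p → z ≢ q →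
                         Adj G p z × Adj G z q
  walk-length≤3⇒middle (step a (step b single)) _ (Any.there (Any.here refl)) _ _ = a , b
  walk-length≤3⇒middle (step _ (step _ single)) _ (Any.here z≡p) z≢p _ = ⊥-elim (z≢p z≡p)
  walk-length≤3⇒middle (step _ (step _ single)) _ (Any.there (Any.there (Any.here z≡q))) _ z≢q =
    ⊥-elim (z≢q z≡q)
  walk-length≤3⇒middle (step _ (step _ (step _ single)))      (s≤s (s≤s (s≤s ()))) _ _ _
  walk-length≤3⇒middle (step _ (step _ (step _ (step _ _)))) (s≤s (s≤s (s≤s ()))) _ _ _
  walk-length≤3⇒middle w@single          _ z∈ z≢p z≢q =
    ⊥-elim ([ z≢p , z≢q ] (walk-length≤2⇒endpoint w (s≤s z≤n) z∈))
  walk-length≤3⇒middle w@(step _ single) _ z∈ z≢p z≢q =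
    ⊥-elim ([ z≢p , z≢q ] (walk-length≤2⇒endpoint w (s≤s (s≤s z≤n)) z∈))

  walk-¬dist≤1⇒3≤length : Walk G p q P → ¬ Dist≤1 p q → 3 ≤ length P
  walk-¬dist≤1⇒3≤length single                       far = ⊥-elim (far (inj₁ refl))
  walk-¬dist≤1⇒3≤length (step a single)              far = ⊥-elim (far (inj₂ a))
  walk-¬dist≤1⇒3≤length (step _ (step _ single))     _   = s≤s (s≤s (s≤s z≤n))
  walk-¬dist≤1⇒3≤length (step _ (step _ (step _ _))) _   = s≤s (s≤s (s≤s z≤n))

  dist≤1⇒short-path : Dist≤1 p q → Σ (List (Fin n)) λ Q → IsPath G p q Q × length Q ≤ 2
  dist≤1⇒short-path (inj₁ refl) = _ , (single , [] ∷ []) , s≤s z≤n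
  dist≤1⇒short-path (inj₂ a)    = _ , (step a single , (adj⇒≢ a ∷ []) ∷ [] ∷ []) , s≤s (s≤s z≤n)

  shortest-internal⇒¬dist≤1 : IsShortestPath G p q P → z ∈ₗ P → z ≢ p → z ≢ q → ¬ Dist≤1 p q
  shortest-internal⇒¬dist≤1 ((w , _) , minimal) z∈ z≢p z≢q d with dist≤1⇒short-path d
  ... | Q , Q-path , |Q|≤2 =
    [ z≢p , z≢q ] (walk-length≤2⇒endpoint w (≤-trans (minimal Q Q-path) |Q|≤2) z∈)

  dist≤1⇒positionable : Dist≤1 p q → Positionable G Z p q
  dist≤1⇒positionable d _ sh _ z∈ z≢p z≢q _ = shortest-internal⇒¬dist≤1 sh z∈ z≢p z≢q d

  inducedP₃⇒shortest : InducedP₃ p c q → IsShortestPath G p q (p ∷ c ∷ q ∷ [])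
  inducedP₃⇒shortest (a , b , far) =
    (step a (step b single) , (adj⇒≢ a ∷ far ∘ inj₁ ∷ []) ∷ (adj⇒≢ b ∷ []) ∷ [] ∷ []) ,
    λ _ (w , _) → walk-¬dist≤1⇒3≤length w far

  inducedP₃-centre-∉ : Positionable G Z p q → InducedP₃ p c q → c ∉ Z
  inducedP₃-centre-∉ pos P₃@(a , b , _) =
    pos _ (inducedP₃⇒shortest P₃) _ (Any.there (Any.here refl)) (≢-sym (adj⇒≢ a)) (adj⇒≢ b)

  positionable-via-common-neighbour :
    Adj G p c → Adj G c q → (∀ {z} → Adj G p z → Adj G z q → z ∈ Z → Dist≤1 p q) →
    Positionable G Z p q
  positionable-via-common-neighbour {p = p} {q = q} a b close _ sh@((w , _) , minimal) z z∈ z≢p z≢q z∈Z =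
    far (close (proj₁ z-middle) (proj₂ z-middle) z∈Z)
    where
    far : ¬ Dist≤1 p q
    far = shortest-internal⇒¬dist≤1 sh z∈ z≢p z≢q
    z-middle : Adj G p z × Adj G z q
    z-middle = walk-length≤3⇒middle w (minimal _ (proj₁ (inducedP₃⇒shortest (a , b , far)))) z∈ z≢p z≢q

  claw-centre-∉ : IsDualGP G Z → Adj G h a → Adj G h b → Adj G h c →
                  ¬ Dist≤1 a b → ¬ Dist≤1 a c → ¬ Dist≤1 b c → h ∉ Z
  claw-centre-∉ {Z = Z} {a = a} {b = b} {c = c} (inZ , outZ) h~a h~b h~c a≁b a≁c b≁c
    with a ∈? Z | b ∈? Z | c ∈? Z
  ... | yes a∈ | yes b∈ | _      = inducedP₃-centre-∉ (inZ a b a∈ b∈) (symAdj G h~a , h~b , a≁b)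
  ... | no a∉  | no b∉  | _      = inducedP₃-centre-∉ (outZ a b a∉ b∉) (symAdj G h~a , h~b , a≁b)
  ... | yes a∈ | no _   | yes c∈ = inducedP₃-centre-∉ (inZ a c a∈ c∈) (symAdj G h~a , h~c , a≁c)
  ... | no a∉  | yes _  | no c∉  = inducedP₃-centre-∉ (outZ a c a∉ c∉) (symAdj G h~a , h~c , a≁c)
  ... | no _   | yes b∈ | yes c∈ = inducedP₃-centre-∉ (inZ b c b∈ c∈) (symAdj G h~b , h~c , b≁c)
  ... | yes _  | no b∉  | no c∉  = inducedP₃-centre-∉ (outZ b c b∉ c∉) (symAdj G h~b , h~c , b≁c)

  inducedP₃⇒∣dualGP∣<n : IsDualGP G Z → InducedP₃ p c q → ∣ Z ∣ < n
  inducedP₃⇒∣dualGP∣<n {Z = Z} {p = p} {q = q} (inZ , _) P₃ with p ∈? Z | q ∈? Z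
  ... | no p∉  | _      = x∉p⇒∣p∣<n p∉
  ... | yes _  | no q∉  = x∉p⇒∣p∣<n q∉
  ... | yes p∈ | yes q∈ = x∉p⇒∣p∣<n (inducedP₃-centre-∉ (inZ p q p∈ q∈) P₃)

module _ {n : ℕ} (G : Graph (suc n)) (x : Fin (suc n)) where

  private variable
    i j : Fin n
    p c q : Fin (suc n)

  dist≤1-punchIn⁺ : Dist≤1 G (punchIn x i) (punchIn x j) → Dist≤1 (G -ᵥ x) i j
  dist≤1-punchIn⁺ {i} {j} (inj₁ eq) = inj₁ (punchIn-injective x i j eq)
  dist≤1-punchIn⁺         (inj₂ a)  = inj₂ a

  dist≤1-punchIn⁻ : Dist≤1 (G -ᵥ x) i j → Dist≤1 G (punchIn x i) (punchIn x j)
  dist≤1-punchIn⁻ (inj₁ refl) = inj₁ refl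
  dist≤1-punchIn⁻ (inj₂ a)    = inj₂ a

  inducedP₃-punchOut : (x≢p : x ≢ p) (x≢c : x ≢ c) (x≢q : x ≢ q) → InducedP₃ G p c q →
    InducedP₃ (G -ᵥ x) (punchOut x≢p) (punchOut x≢c) (punchOut x≢q)
  inducedP₃-punchOut x≢p x≢c x≢q (p~c , c~q , p≁q) =
    subst₂ (Adj G) (sym ↑p) (sym ↑c) p~c ,
    subst₂ (Adj G) (sym ↑c) (sym ↑q) c~q ,
    p≁q ∘ subst₂ (Dist≤1 G) ↑p ↑q ∘ dist≤1-punchIn⁻
    where
    ↑p = punchIn-punchOut x≢p
    ↑c = punchIn-punchOut x≢c
    ↑q = punchIn-punchOut x≢q

-- In Y k the indices below k are the hubs v_i, those below k + 3 form the clique K_{k+3},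
-- and the remaining two, x and y, are the leaves.
module _ {k : ℕ} where

  private variable
    a b : ℕ
    h p q : Fin (5 + k)

  hub-YRel : a < k → YRel k a b
  hub-YRel {a} {b} a<k with b <? k + 3
  ... | yes b<k+3 = inj₁ (<-≤-trans a<k (m≤m+n k 3) , b<k+3)
  ... | no  b≮k+3 = inj₂ (inj₁ (a<k , ≮⇒≥ b≮k+3))

  leaf-¬YRel : k + 3 ≤ a → k ≤ b → ¬ YRel k a b
  leaf-¬YRel k+3≤a _   (inj₁ (a<k+3 , _))      = <⇒≱ a<k+3 k+3≤a
  leaf-¬YRel k+3≤a _   (inj₂ (inj₁ (a<k , _))) = <⇒≱ a<k (≤-trans (m≤m+n k 3) k+3≤a)
  leaf-¬YRel _     k≤b (inj₂ (inj₂ (_ , b<k))) = <⇒≱ b<k k≤b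

  nonhub-YRel⇒core : k ≤ a → k ≤ b → YRel k a b → a < k + 3 × b < k + 3
  nonhub-YRel⇒core _   _   (inj₁ core)             = core
  nonhub-YRel⇒core k≤a _   (inj₂ (inj₁ (a<k , _))) = ⊥-elim (<⇒≱ a<k k≤a)
  nonhub-YRel⇒core _   k≤b (inj₂ (inj₂ (_ , b<k))) = ⊥-elim (<⇒≱ b<k k≤b)

  hub-adj : toℕ h < k → k ≤ toℕ p → Adj (Y k) h p
  hub-adj h<k k≤p = <⇒≢ (<-≤-trans h<k k≤p) , hub-YRel h<k

  core-dist≤1 : toℕ p < k + 3 → toℕ q < k + 3 → Dist≤1 (Y k) p q
  core-dist≤1 {p} {q} p<k+3 q<k+3 with p ≟ q
  ... | yes p≡q = inj₁ p≡q
  ... | no  p≢q = inj₂ (p≢q , inj₁ (p<k+3 , q<k+3))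

  leaf-far : k + 3 ≤ toℕ p → k ≤ toℕ q → toℕ q < toℕ p → ¬ Dist≤1 (Y k) p q
  leaf-far _     _   q<p (inj₁ refl)      = <-irrefl refl q<p
  leaf-far k+3≤p k≤q _   (inj₂ (_ , rel)) = leaf-¬YRel k+3≤p k≤q rel

module Yₖ (k : ℕ) where

  v₁ u x y : Fin (5 + k)
  v₁ = Fin.zero
  u  = fromℕ< (m<n+m k z<s)
  x  = xY k
  y  = fromℕ (4 + k)

  u-index : toℕ u ≡ k
  u-index = toℕ-fromℕ< _

  x-index : toℕ x ≡ k + 3
  x-index = toℕ-fromℕ< _

  y-index : toℕ y ≡ suc (k + 3)
  y-index = trans (toℕ-fromℕ (4 + k)) (cong suc (+-comm 3 k))

  k≤u : k ≤ toℕ u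
  k≤u = ≤-reflexive (sym u-index)

  k+3≤x : k + 3 ≤ toℕ x
  k+3≤x = ≤-reflexive (sym x-index)

  k+3≤y : k + 3 ≤ toℕ y
  k+3≤y = m≤n⇒m≤1+n (≤-reflexive (cong pred (sym y-index)))

  k≤x : k ≤ toℕ x
  k≤x = ≤-trans (m≤m+n k 3) k+3≤x

  k≤y : k ≤ toℕ y
  k≤y = ≤-trans (m≤m+n k 3) k+3≤y

  u<x : toℕ u < toℕ x
  u<x = ≤-<-trans (≤-reflexive u-index) (<-≤-trans (m<m+n k z<s) k+3≤x)

  x<y : toℕ x < toℕ y
  x<y = ≤-<-trans (≤-reflexive x-index) (≤-reflexive (sym y-index))

  u<y : toℕ u < toℕ y
  u<y = <-trans u<x x<y

  y≁x : ¬ Dist≤1 (Y k) y x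
  y≁x = leaf-far k+3≤y k≤x x<y

  y≁u : ¬ Dist≤1 (Y k) y u
  y≁u = leaf-far k+3≤y k≤u u<y

  x≁u : ¬ Dist≤1 (Y k) x u
  x≁u = leaf-far k+3≤x k≤u u<x

  x≢y : x ≢ y
  x≢y = <⇒≢ x<y

  x≢u : x ≢ u
  x≢u = ≢-sym (<⇒≢ u<x)

  below-x : ∀ {j} → j ≢ x → j ≢ y → toℕ j < k + 3
  below-x {j} j≢x j≢y = ≤∧≢⇒< j≤k+3 (j≢x ∘ toℕ-injective ∘ λ e → trans e (sym x-index))
    where
    j≤k+3 : toℕ j ≤ k + 3
    j≤k+3 = m<1+n⇒m≤n (subst (toℕ j <_) y-index (≤∧≢⇒<ᶠ (≤fromℕ j) j≢y))

uvwxy : ∀ k → Subset (5 + k)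
uvwxy zero    = ⊤
uvwxy (suc k) = outside ∷ uvwxy k

∣uvwxy∣≡5 : ∀ k → ∣ uvwxy k ∣ ≡ 5
∣uvwxy∣≡5 zero    = refl
∣uvwxy∣≡5 (suc k) = ∣uvwxy∣≡5 k

∈uvwxy⇒k≤ : ∀ k {i : Fin (5 + k)} → i ∈ uvwxy k → k ≤ toℕ i
∈uvwxy⇒k≤ zero    _ = z≤n
∈uvwxy⇒k≤ (suc k) {Fin.suc i} (there i∈) = s≤s (∈uvwxy⇒k≤ k i∈)

k≤⇒∈uvwxy : ∀ k {i : Fin (5 + k)} → k ≤ toℕ i → i ∈ uvwxy k
k≤⇒∈uvwxy zero    _ = ∈⊤
k≤⇒∈uvwxy (suc k) {Fin.suc i} (s≤s k≤i) = there (k≤⇒∈uvwxy k k≤i)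

∉uvwxy⇒<k : ∀ k {i : Fin (5 + k)} → i ∉ uvwxy k → toℕ i < k
∉uvwxy⇒<k k i∉ = ≰⇒> (i∉ ∘ k≤⇒∈uvwxy k)

module _ {k : ℕ} (0<k : 0 < k) where
  open Yₖ k

  uvwxy-dualGP : IsDualGP (Y k) (uvwxy k)
  uvwxy-dualGP = inside-pairs , outside-pairs
    where
    inside-pairs : ∀ p q → p ∈ uvwxy k → q ∈ uvwxy k → Positionable (Y k) (uvwxy k) p q
    inside-pairs p q p∈ q∈ =
      positionable-via-common-neighbour (Y k) (symAdj (Y k) (hub-adj 0<k k≤p)) (hub-adj 0<k k≤q)
        λ p~z z~q z∈ → core-dist≤1 (proj₁ (nonhub-YRel⇒core k≤p (∈uvwxy⇒k≤ k z∈) (proj₂ p~z)))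
                                   (proj₂ (nonhub-YRel⇒core (∈uvwxy⇒k≤ k z∈) k≤q (proj₂ z~q)))
      where
      k≤p = ∈uvwxy⇒k≤ k p∈
      k≤q = ∈uvwxy⇒k≤ k q∈
    outside-pairs : ∀ p q → p ∉ uvwxy k → q ∉ uvwxy k → Positionable (Y k) (uvwxy k) p q
    outside-pairs p q p∉ q∉ = dist≤1⇒positionable (Y k)
      (core-dist≤1 (<-≤-trans (∉uvwxy⇒<k k p∉) (m≤m+n k 3)) (<-≤-trans (∉uvwxy⇒<k k q∉) (m≤m+n k 3)))

  dualGP-hub∉ : ∀ {Z h} → IsDualGP (Y k) Z → toℕ h < k → h ∉ Z
  dualGP-hub∉ dgp h<k =
    claw-centre-∉ (Y k) dgp (hub-adj h<k k≤y) (hub-adj h<k k≤x) (hub-adj h<k k≤u) y≁x y≁u x≁u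

  dualGP⊆uvwxy : ∀ {Z} → IsDualGP (Y k) Z → Z ⊆ uvwxy k
  dualGP⊆uvwxy dgp i∈Z = k≤⇒∈uvwxy k (≮⇒≥ λ i<k → dualGP-hub∉ dgp i<k i∈Z)

  gpd-Y : GpdIs (Y k) 5
  gpd-Y = (uvwxy k , uvwxy-dualGP , ∣uvwxy∣≡5 k) ,
          λ Z dgp → subst (∣ Z ∣ ≤_) (∣uvwxy∣≡5 k) (p⊆q⇒∣p∣≤∣q∣ (dualGP⊆uvwxy dgp))

module Yₖ-x (k : ℕ) where
  open Yₖ k

  G′ : Graph (4 + k)
  G′ = Y k -ᵥ x

  y′ : Fin (4 + k)
  y′ = punchOut x≢y

  punchIn-below-x : ∀ {j} → j ≢ y′ → toℕ (punchIn x j) < k + 3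
  punchIn-below-x {j} j≢y′ = below-x (punchInᵢ≢i x j) λ eq →
    j≢y′ (punchIn-injective x j y′ (trans eq (sym (punchIn-punchOut x≢y))))

  all-but-y-dualGP : IsDualGP G′ (∁ ⁅ y′ ⁆)
  all-but-y-dualGP = inside-pairs , outside-pairs
    where
    inside-pairs : ∀ p q → p ∈ ∁ ⁅ y′ ⁆ → q ∈ ∁ ⁅ y′ ⁆ → Positionable G′ (∁ ⁅ y′ ⁆) p q
    inside-pairs p q p∈ q∈ = dist≤1⇒positionable G′ (dist≤1-punchIn⁺ (Y k) x
      (core-dist≤1 (punchIn-below-x (x∉⁅y⁆⇒x≢y (x∈∁p⇒x∉p p∈)))
                   (punchIn-below-x (x∉⁅y⁆⇒x≢y (x∈∁p⇒x∉p q∈)))))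
    outside-pairs : ∀ p q → p ∉ ∁ ⁅ y′ ⁆ → q ∉ ∁ ⁅ y′ ⁆ → Positionable G′ (∁ ⁅ y′ ⁆) p q
    outside-pairs p q p∉ q∉ = dist≤1⇒positionable G′
      (inj₁ (trans (x∈⁅y⁆⇒x≡y y′ (x∉∁p⇒x∈p p∉)) (sym (x∈⁅y⁆⇒x≡y y′ (x∉∁p⇒x∈p q∉)))))

  ∣all-but-y∣≡k+3 : ∣ ∁ ⁅ y′ ⁆ ∣ ≡ k + 3
  ∣all-but-y∣≡k+3 = begin
    ∣ ∁ ⁅ y′ ⁆ ∣         ≡⟨ ∣∁p∣≡n∸∣p∣ ⁅ y′ ⁆ ⟩
    4 + k ∸ ∣ ⁅ y′ ⁆ ∣   ≡⟨ cong (4 + k ∸_) (∣⁅x⁆∣≡1 y′) ⟩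
    3 + k                ≡⟨ +-comm 3 k ⟩
    k + 3                ∎
    where open ≡-Reasoning

module _ {k : ℕ} (0<k : 0 < k) where
  open Yₖ k
  open Yₖ-x k

  x≢v₁ : x ≢ v₁
  x≢v₁ = ≢-sym (<⇒≢ (<-≤-trans 0<k k≤x))

  y-v₁-u-inducedP₃ : InducedP₃ G′ y′ (punchOut x≢v₁) (punchOut x≢u)
  y-v₁-u-inducedP₃ = inducedP₃-punchOut (Y k) x x≢y x≢v₁ x≢u
    (symAdj (Y k) (hub-adj 0<k k≤y) , hub-adj 0<k k≤u , y≁u)

  gpd-Y-x : GpdIs (Y k -ᵥ x) (k + 3)
  gpd-Y-x = (∁ ⁅ y′ ⁆ , all-but-y-dualGP , ∣all-but-y∣≡k+3) ,
            λ Z dgp → subst (∣ Z ∣ ≤_) (+-comm 3 k)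
                            (m<1+n⇒m≤n (inducedP₃⇒∣dualGP∣<n G′ dgp y-v₁-u-inducedP₃))

proposition3p9 : (k : ℕ) → 2 ≤ k →
    GpdIs (Y k) 5 × GpdIs (Y k -ᵥ xY k) (k + 3)
proposition3p9 k 2≤k = gpd-Y 0<k , gpd-Y-x 0<k
  where
  0<k : 0 < k
  0<k = <-≤-trans (s≤s z≤n) 2≤k
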